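{- Let $(X,A,m,\alpha,r)$ be a reversible micro-macro system with $r$ entropy preserving. Then: (a) $|D|=|I|$; (b) for $\varepsilon\ge 0$, $\frac{|D|}{|X|}\le\varepsilon$ if and only if $\frac{|C|}{|X|}\ge1-2\varepsilon$; (c) for every $n\ge1$, $|D_n|=|I_n|$, where $D_n=\{i\in X: S(i)>S(\alpha i)>\cdots>S(\alpha^n i)\}$ and $I_n=\{i\in X: S(i)<S(\alpha i)<\cdots<S(\alpha^n i)\}$.
   Context: A micro-macro system $(X,A,m,\alpha)$ consists of finite sets $X$, $A$, a bijection $\alpha:X\to X$ and a surjection $m:X\to A$; $S(i)=\ln|m^{ -1}(m(i))|$ for $i\in X$. It is reversible with reversion $r:X\to X$ if $r^2=\mathrm{id}$ and $\alpha^{ -1}=r\alpha r$; $r$ is entropy preserving if $S(ri)=S(i)$ for all $i$. $D=\{i:S(\alpha i)<S(i)\}$, $C=\{i:S(\alpha i)=S(i)\}$, $I=\{i:S(\alpha i)>S(i)\}$.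
   Formalization: The parameter ε in part (b) ranges over the nonnegative rationals. -}

module Defs where

open import Level using (0ℓ)
open import Data.Nat using (ℕ; zero; suc; _<_; NonZero)
open import Data.Nat.Properties using (_<?_)
open import Data.Nat.Properties as ℕP using ()
open import Data.Fin using (Fin; toℕ) renaming (_≟_ to _≟ᶠ_)
open import Data.Fin.Properties using (all?)
open import Data.List using (List; length; filter; allFin)
open import Data.Integer using (+_)
open import Data.Rational using (ℚ; _/_)
open import Relation.Binary.PropositionalEquality using (_≡_)
open import Relation.Unary using (Pred; Decidable)
open import Function.Bundles using (_↔_; Inverse)

card : ∀ {n} {P : Pred (Fin n) 0ℓ} → Decidable P → ℕ
card {n} P? = length (filter P? (allFin n))

iter : ∀ {a} {X : Set a} → (X → X) → ℕ → X → X
iter f zero    x = x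
iter f (suc k) x = f (iter f k x)

ratio : ℕ → (q : ℕ) → .{{NonZero q}} → ℚ
ratio p q = (+ p) / q

module MicroMacro {N K : ℕ} (m : Fin N → Fin K) (α : Fin N ↔ Fin N) where

  αf : Fin N → Fin N
  αf = Inverse.to α

  -- W i = |m⁻¹(m i)|, the size of the macrostate of i.
  -- The entropy is S i = ln (W i); since ln is strictly increasing on
  -- positive numbers, S i < S j ⇔ W i < W j and S i ≡ S j ⇔ W i ≡ W j.
  W : Fin N → ℕ
  W i = card (λ j → m j ≟ᶠ m i)

  D? : Decidable (λ i → W (αf i) < W i)
  D? i = W (αf i) <? W i

  C? : Decidable (λ i → W (αf i) ≡ W i)
  C? i = W (αf i) ℕP.≟ W i

  I? : Decidable (λ i → W i < W (αf i))
  I? i = W i <? W (αf i)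

  Dn? : (n : ℕ) → Decidable (λ i → (k : Fin n) → W (iter αf (suc (toℕ k)) i) < W (iter αf (toℕ k) i))
  Dn? n i = all? (λ k → W (iter αf (suc (toℕ k)) i) <? W (iter αf (toℕ k) i))

  In? : (n : ℕ) → Decidable (λ i → (k : Fin n) → W (iter αf (toℕ k) i) < W (iter αf (suc (toℕ k)) i))
  In? n i = all? (λ k → W (iter αf (toℕ k) i) <? W (iter αf (suc (toℕ k)) i))

  cardD cardC cardI : ℕ
  cardD = card D?
  cardC = card C?
  cardI = card I?

  cardDn cardIn : ℕ → ℕ
  cardDn n = card (Dn? n)
  cardIn n = card (In? n)

{-# OPTIONS --safe #-}
module Submission where

-- Since α r = r α⁻¹, the map ρₙ = r ∘ αⁿ is an involution of X that runs trajectories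
-- backwards: αᵏ (ρₙ i) = r (αʲ i) whenever k + j = n.  As r preserves entropy, ρ₁ exchanges
-- D and I and ρₙ exchanges Dₙ and Iₙ, so these sets are equinumerous.  Since D, C, I
-- partition X, this gives |C|/|X| = 1 − 2|D|/|X|, and (b) holds because x ↦ 1 − 2x is
-- strictly decreasing.

open import Defs
open import Level using (Level; 0ℓ)
open import Data.Bool using (true; false; if_then_else_)
open import Data.Fin using (Fin; toℕ; opposite)
open import Data.Fin.Permutation using (Permutation′; permutation; _⟨$⟩ʳ_)
open import Data.Fin.Properties using (toℕ<n; opposite-prop; opposite-involutive)
open import Data.Integer as ℤ using (+_)
import Data.Integer.Properties as ℤP
open import Data.Integer.Solver using (module +-*-Solver)
open import Data.List using (List; []; _∷_; length; filter; tabulate; allFin)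
open import Data.List.Properties using (length-tabulate)
open import Data.Nat as ℕ using (ℕ; NonZero; _≥_; zero; suc)
import Data.Nat.Properties as ℕP
open import Algebra.Properties.CommutativeMonoid.Sum ℕP.+-0-commutativeMonoid
  using (sum; sum-cong-≗; sum-permute)
open import Data.Nat.Tactic.RingSolver using (solve-∀)
open import Data.Product using (_×_; _,_)
open import Data.Rational using (ℚ; 0ℚ; 1ℚ; _≤_; _<_; _-_; _*_; _+_; toℚᵘ)
open import Data.Rational.Properties
  using (toℚᵘ-injective; toℚᵘ-fromℚᵘ; toℚᵘ-homo-+; +-monoʳ-≤; +-monoʳ-<; neg-antimono-≤; neg-antimono-<;
         *-monoˡ-≤-nonNeg; *-monoʳ-<-pos; ≮⇒≥; <-≤-trans; <-irrefl)
import Data.Rational.Solver as ℚSolver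
open import Data.Rational.Unnormalised as ℚᵘ using (*≡*) renaming (_/_ to _/ᵘ_)
import Data.Rational.Unnormalised.Properties as ℚᵘP
open import Function using (id; _∘_; _↔_; Inverse; _⇔_; Equivalence; mk⇔)
open import Function.Definitions using (Surjective)
open import Relation.Binary.Definitions using (Tri; tri<; tri≈; tri>)
open import Relation.Binary.PropositionalEquality
  using (_≡_; refl; sym; trans; cong; cong₂; subst; module ≡-Reasoning)
open import Relation.Nullary using (Dec; yes; no; does)
open import Relation.Nullary.Decidable using (dec-true; dec-false)
open import Relation.Unary using (Pred; Decidable)

private
  variable
    a ℓ : Level
    A B : Set a

𝟙 : Dec A → ℕ
𝟙 A? = if does A? then 1 else 0

𝟙-cong : A ⇔ B → (A? : Dec A) (B? : Dec B) → 𝟙 A? ≡ 𝟙 B?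
𝟙-cong A⇔B (yes a) B? rewrite dec-true  B? (Equivalence.to A⇔B a)     = refl
𝟙-cong A⇔B (no ¬a) B? rewrite dec-false B? (¬a ∘ Equivalence.from A⇔B) = refl

𝟙-trichotomy : {C : Set ℓ} → Tri A B C → (A? : Dec A) (B? : Dec B) (C? : Dec C) →
               𝟙 A? ℕ.+ 𝟙 B? ℕ.+ 𝟙 C? ≡ 1
𝟙-trichotomy (tri< a ¬b ¬c) A? B? C?
  rewrite dec-true A? a | dec-false B? ¬b | dec-false C? ¬c = refl
𝟙-trichotomy (tri≈ ¬a b ¬c) A? B? C?
  rewrite dec-false A? ¬a | dec-true B? b | dec-false C? ¬c = refl
𝟙-trichotomy (tri> ¬a ¬b c) A? B? C?
  rewrite dec-false A? ¬a | dec-false B? ¬b | dec-true C? c = refl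

length-filter-∷ : {P : Pred A ℓ} (P? : Decidable P) (x : A) (xs : List A) →
                  length (filter P? (x ∷ xs)) ≡ 𝟙 (P? x) ℕ.+ length (filter P? xs)
length-filter-∷ P? x xs with does (P? x)
... | true  = refl
... | false = refl

length-filter-trichotomy : {P Q R : Pred A ℓ} (P? : Decidable P) (Q? : Decidable Q) (R? : Decidable R) →
  (∀ x → Tri (P x) (Q x) (R x)) → ∀ xs →
  length (filter P? xs) ℕ.+ length (filter Q? xs) ℕ.+ length (filter R? xs) ≡ length xs
length-filter-trichotomy P? Q? R? tri [] = refl
length-filter-trichotomy P? Q? R? tri (x ∷ xs) = begin
  ∣ P? ∣ (x ∷ xs) ℕ.+ ∣ Q? ∣ (x ∷ xs) ℕ.+ ∣ R? ∣ (x ∷ xs)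
    ≡⟨ cong₂ ℕ._+_ (cong₂ ℕ._+_ (length-filter-∷ P? x xs) (length-filter-∷ Q? x xs)) (length-filter-∷ R? x xs) ⟩
  (𝟙 (P? x) ℕ.+ ∣ P? ∣ xs) ℕ.+ (𝟙 (Q? x) ℕ.+ ∣ Q? ∣ xs) ℕ.+ (𝟙 (R? x) ℕ.+ ∣ R? ∣ xs)
    ≡⟨ interchange (𝟙 (P? x)) (𝟙 (Q? x)) (𝟙 (R? x)) (∣ P? ∣ xs) (∣ Q? ∣ xs) (∣ R? ∣ xs) ⟩
  (𝟙 (P? x) ℕ.+ 𝟙 (Q? x) ℕ.+ 𝟙 (R? x)) ℕ.+ (∣ P? ∣ xs ℕ.+ ∣ Q? ∣ xs ℕ.+ ∣ R? ∣ xs)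
    ≡⟨ cong₂ ℕ._+_ (𝟙-trichotomy (tri x) (P? x) (Q? x) (R? x)) (length-filter-trichotomy P? Q? R? tri xs) ⟩
  suc (length xs) ∎
  where
  open ≡-Reasoning
  ∣_∣ : {S : Pred A ℓ} → Decidable S → List A → ℕ
  ∣ S? ∣ ys = length (filter S? ys)
  interchange : ∀ a b c d e f → (a ℕ.+ d) ℕ.+ (b ℕ.+ e) ℕ.+ (c ℕ.+ f) ≡ (a ℕ.+ b ℕ.+ c) ℕ.+ (d ℕ.+ e ℕ.+ f)
  interchange = solve-∀

module _ {n : ℕ} where

  card≡sum-𝟙 : {P : Pred (Fin n) 0ℓ} (P? : Decidable P) → card P? ≡ sum (𝟙 ∘ P?)
  card≡sum-𝟙 P? = length-filter-tabulate id
    where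
    length-filter-tabulate : ∀ {m} (f : Fin m → Fin n) →
      length (filter P? (tabulate f)) ≡ sum (𝟙 ∘ P? ∘ f)
    length-filter-tabulate {zero}  f = refl
    length-filter-tabulate {suc m} f with does (P? (f Fin.zero))
    ... | true  = cong suc (length-filter-tabulate (f ∘ Fin.suc))
    ... | false = length-filter-tabulate (f ∘ Fin.suc)

  card-permute : {P Q : Pred (Fin n) 0ℓ} (P? : Decidable P) (Q? : Decidable Q) (π : Permutation′ n) →
                 (∀ i → P i ⇔ Q (π ⟨$⟩ʳ i)) → card P? ≡ card Q?
  card-permute P? Q? π P⇔Qπ = begin
    card P?                      ≡⟨ card≡sum-𝟙 P? ⟩
    sum (𝟙 ∘ P?)                 ≡⟨ sum-cong-≗ (λ i → 𝟙-cong (P⇔Qπ i) (P? i) (Q? (π ⟨$⟩ʳ i))) ⟩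
    sum (𝟙 ∘ Q? ∘ (π ⟨$⟩ʳ_))    ≡⟨ sum-permute (𝟙 ∘ Q?) π ⟨
    sum (𝟙 ∘ Q?)                 ≡⟨ card≡sum-𝟙 Q? ⟨
    card Q?                      ∎
    where open ≡-Reasoning

  card-trichotomy : {P Q R : Pred (Fin n) 0ℓ} (P? : Decidable P) (Q? : Decidable Q) (R? : Decidable R) →
                    (∀ i → Tri (P i) (Q i) (R i)) → card P? ℕ.+ card Q? ℕ.+ card R? ≡ n
  card-trichotomy P? Q? R? tri =
    trans (length-filter-trichotomy P? Q? R? tri (allFin n)) (length-tabulate id)

module _ {X : Set a} where

  iter-+ : (f : X → X) (k j : ℕ) (x : X) → iter f (k ℕ.+ j) x ≡ iter f k (iter f j x)
  iter-+ f zero    j x = refl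
  iter-+ f (suc k) j x = cong f (iter-+ f k j x)

  iter-suc : (f : X → X) (k : ℕ) (x : X) → iter f (suc k) x ≡ iter f k (f x)
  iter-suc f zero    x = refl
  iter-suc f (suc k) x = cong f (iter-suc f k x)

  iter-cancel : {f g : X → X} → (∀ x → g (f x) ≡ x) → ∀ k x → iter g k (iter f k x) ≡ x
  iter-cancel g∘f≗id zero    x = refl
  iter-cancel {f} {g} g∘f≗id (suc k) x = begin
    iter g (suc k) (f (iter f k x))   ≡⟨ iter-suc g k _ ⟩
    iter g k (g (f (iter f k x)))     ≡⟨ cong (iter g k) (g∘f≗id _) ⟩
    iter g k (iter f k x)             ≡⟨ iter-cancel g∘f≗id k x ⟩
    x                                 ∎
    where open ≡-Reasoning

  iter-intertwine : {f g h : X → X} → (∀ x → f (h x) ≡ h (g x)) → ∀ k x → iter f k (h x) ≡ h (iter g k x)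
  iter-intertwine f∘h≗h∘g zero    x = refl
  iter-intertwine {f} f∘h≗h∘g (suc k) x = trans (cong f (iter-intertwine f∘h≗h∘g k x)) (f∘h≗h∘g _)

module TimeReversal {X : Set a} (α α⁻¹ : X → X) (α⁻¹∘α : ∀ x → α⁻¹ (α x) ≡ x) (r : X → X)
    (r-involutive : ∀ x → r (r x) ≡ x) (α⁻¹≡rαr : ∀ x → α⁻¹ x ≡ r (α (r x))) where

  α∘r : ∀ x → α (r x) ≡ r (α⁻¹ x)
  α∘r x = trans (sym (r-involutive _)) (cong r (sym (α⁻¹≡rαr x)))

  reverse : ℕ → X → X
  reverse n x = r (iter α n x)

  iter-reverse : ∀ {k j n} → k ℕ.+ j ≡ n → ∀ x → iter α k (reverse n x) ≡ r (iter α j x)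
  iter-reverse {k} {j} refl x = begin
    iter α k (r (iter α (k ℕ.+ j) x))     ≡⟨ iter-intertwine α∘r k _ ⟩
    r (iter α⁻¹ k (iter α (k ℕ.+ j) x))   ≡⟨ cong (r ∘ iter α⁻¹ k) (iter-+ α k j x) ⟩
    r (iter α⁻¹ k (iter α k (iter α j x))) ≡⟨ cong r (iter-cancel α⁻¹∘α k _) ⟩
    r (iter α j x)                        ∎
    where open ≡-Reasoning

  reverse-involutive : ∀ n x → reverse n (reverse n x) ≡ x
  reverse-involutive n x = trans (cong r (iter-reverse {n} {0} (ℕP.+-identityʳ n) x)) (r-involutive x)

toℚᵘ-ratio : ∀ p n .{{_ : NonZero n}} → toℚᵘ (ratio p n) ℚᵘ.≃ (+ p) /ᵘ n
toℚᵘ-ratio p (suc n) = toℚᵘ-fromℚᵘ ((+ p) /ᵘ suc n)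

ratio-+ : ∀ p q n .{{_ : NonZero n}} → ratio (p ℕ.+ q) n ≡ ratio p n + ratio q n
ratio-+ p q n@(suc _) = toℚᵘ-injective (begin
  toℚᵘ (ratio (p ℕ.+ q) n)            ≈⟨ toℚᵘ-ratio (p ℕ.+ q) n ⟩
  + (p ℕ.+ q) /ᵘ n                   ≈⟨ same-denominator ⟩
  (+ p /ᵘ n) ℚᵘ.+ (+ q /ᵘ n)          ≈⟨ ℚᵘP.+-cong (toℚᵘ-ratio p n) (toℚᵘ-ratio q n) ⟨
  toℚᵘ (ratio p n) ℚᵘ.+ toℚᵘ (ratio q n) ≈⟨ toℚᵘ-homo-+ (ratio p n) (ratio q n) ⟨
  toℚᵘ (ratio p n + ratio q n)        ∎)
  where
  open ℚᵘP.≃-Reasoning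
  open +-*-Solver
  distrib : ∀ x y z → (x ℤ.+ y) ℤ.* (z ℤ.* z) ≡ (x ℤ.* z ℤ.+ y ℤ.* z) ℤ.* z
  distrib = solve 3 (λ x y z → (x :+ y) :* (z :* z) := (x :* z :+ y :* z) :* z) refl
  same-denominator : + (p ℕ.+ q) /ᵘ n ℚᵘ.≃ (+ p /ᵘ n) ℚᵘ.+ (+ q /ᵘ n)
  same-denominator = *≡* (trans (cong (ℤ._* (+ n ℤ.* + n)) (ℤP.pos-+ p q)) (distrib (+ p) (+ q) (+ n)))

ratio-self : ∀ n .{{_ : NonZero n}} → ratio n n ≡ 1ℚ
ratio-self n@(suc _) = toℚᵘ-injective (ℚᵘP.≃-trans (toℚᵘ-ratio n n) (*≡* (ℤP.*-comm (+ n) (+ 1))))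

ratio-complement : ∀ c d n .{{_ : NonZero n}} → c ℕ.+ d ℕ.+ d ≡ n →
                   ratio c n ≡ 1ℚ - (1ℚ + 1ℚ) * ratio d n
ratio-complement c d n c+2d≡n = begin
  ratio c n                                                    ≡⟨ isolate (ratio c n) (ratio d n) ⟩
  (ratio c n + ratio d n + ratio d n) - (1ℚ + 1ℚ) * ratio d n  ≡⟨ cong (_- (1ℚ + 1ℚ) * ratio d n) sum≡1 ⟩
  1ℚ - (1ℚ + 1ℚ) * ratio d n                                   ∎
  where
  open ≡-Reasoning
  open ℚSolver.+-*-Solver
  isolate : ∀ y x → y ≡ (y + x + x) - (1ℚ + 1ℚ) * x
  isolate = solve 2 (λ y x → y := (y :+ x :+ x) :- (con 1ℚ :+ con 1ℚ) :* x) refl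
  sum≡1 : ratio c n + ratio d n + ratio d n ≡ 1ℚ
  sum≡1 = begin
    ratio c n + ratio d n + ratio d n ≡⟨ cong (_+ ratio d n) (ratio-+ c d n) ⟨
    ratio (c ℕ.+ d) n + ratio d n     ≡⟨ ratio-+ (c ℕ.+ d) d n ⟨
    ratio (c ℕ.+ d ℕ.+ d) n           ≡⟨ cong (λ k → ratio k n) c+2d≡n ⟩
    ratio n n                         ≡⟨ ratio-self n ⟩
    1ℚ                                ∎

≤⇔1-2*-≥ : ∀ x y → (x ≤ y ⇔ 1ℚ - (1ℚ + 1ℚ) * y ≤ 1ℚ - (1ℚ + 1ℚ) * x)
≤⇔1-2*-≥ x y = mk⇔ antimono-≤ reflect
  where
  f : ℚ → ℚ
  f z = 1ℚ - (1ℚ + 1ℚ) * z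
  antimono-≤ : ∀ {u v} → u ≤ v → f v ≤ f u
  antimono-≤ u≤v = +-monoʳ-≤ 1ℚ (neg-antimono-≤ (*-monoˡ-≤-nonNeg (1ℚ + 1ℚ) u≤v))
  antimono-< : ∀ {u v} → u < v → f v < f u
  antimono-< u<v = +-monoʳ-< 1ℚ (neg-antimono-< (*-monoʳ-<-pos (1ℚ + 1ℚ) u<v))
  reflect : f y ≤ f x → x ≤ y
  reflect fy≤fx = ≮⇒≥ (λ y<x → <-irrefl refl (<-≤-trans (antimono-< y<x) fy≤fx))

<-cong-⇔ : ∀ {m n m′ n′} → m ≡ m′ → n ≡ n′ → (m ℕ.< n) ⇔ (m′ ℕ.< n′)
<-cong-⇔ refl refl = mk⇔ id id

∀-reindex-⇔ : {P Q : A → Set ℓ} (π : A → A) → (∀ x → π (π x) ≡ x) →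
              (∀ x → P x ⇔ Q (π x)) → (∀ x → P x) ⇔ (∀ x → Q x)
∀-reindex-⇔ {Q = Q} π π-involutive P⇔Qπ = mk⇔
  (λ p x → subst Q (π-involutive x) (Equivalence.to (P⇔Qπ (π x)) (p (π x))))
  (λ q x → Equivalence.from (P⇔Qπ x) (q (π x)))

opposite+suc : ∀ {n} (k : Fin n) → toℕ (opposite k) ℕ.+ suc (toℕ k) ≡ n
opposite+suc k = trans (cong (ℕ._+ suc (toℕ k)) (opposite-prop k)) (ℕP.m∸n+n≡m (toℕ<n k))

module ReversibleMicroMacro {N K : ℕ} (m : Fin N → Fin K) (α : Fin N ↔ Fin N) (r : Fin N → Fin N)
    (r-involutive : ∀ i → r (r i) ≡ i)
    (α⁻¹≡rαr : ∀ i → Inverse.from α i ≡ r (Inverse.to α (r i)))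
    (W∘r≗W : ∀ i → MicroMacro.W m α (r i) ≡ MicroMacro.W m α i) where

  open MicroMacro m α
  open TimeReversal αf (Inverse.from α) (Inverse.strictlyInverseʳ α) r r-involutive α⁻¹≡rαr

  W-iter-reverse : ∀ {k j n} → k ℕ.+ j ≡ n → ∀ i → W (iter αf k (reverse n i)) ≡ W (iter αf j i)
  W-iter-reverse {k} {j} k+j≡n i = trans (cong W (iter-reverse {k} {j} k+j≡n i)) (W∘r≗W _)

  reversal : ℕ → Permutation′ N
  reversal n = permutation (reverse n) (reverse n) (reverse-involutive n) (reverse-involutive n)

  cardD≡cardI : cardD ≡ cardI
  cardD≡cardI = card-permute D? I? (reversal 1) λ i →
    <-cong-⇔ (sym (W-iter-reverse {0} {1} refl i)) (sym (W-iter-reverse {1} {0} refl i))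

  cardDn≡cardIn : ∀ n → cardDn n ≡ cardIn n
  cardDn≡cardIn n = card-permute (Dn? n) (In? n) (reversal n) λ i →
    ∀-reindex-⇔ opposite opposite-involutive λ k →
      let k′ = toℕ (opposite k) in
      <-cong-⇔ (sym (W-iter-reverse {k′} (opposite+suc k) i))
               (sym (W-iter-reverse {suc k′} (trans (sym (ℕP.+-suc k′ (toℕ k))) (opposite+suc k)) i))

  cardC+cardD+cardD≡N : cardC ℕ.+ cardD ℕ.+ cardD ≡ N
  cardC+cardD+cardD≡N = begin
    cardC ℕ.+ cardD ℕ.+ cardD  ≡⟨ cong (ℕ._+ cardD) (ℕP.+-comm cardC cardD) ⟩
    cardD ℕ.+ cardC ℕ.+ cardD  ≡⟨ cong (cardD ℕ.+ cardC ℕ.+_) cardD≡cardI ⟩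
    cardD ℕ.+ cardC ℕ.+ cardI  ≡⟨ card-trichotomy D? C? I? (λ i → ℕP.<-cmp (W (αf i)) (W i)) ⟩
    N                          ∎
    where open ≡-Reasoning

  ratioD≤ε⇔1-2ε≤ratioC : .{{_ : NonZero N}} → ∀ ε →
    (ratio cardD N ≤ ε ⇔ 1ℚ - (1ℚ + 1ℚ) * ε ≤ ratio cardC N)
  ratioD≤ε⇔1-2ε≤ratioC ε =
    subst (λ c → ratio cardD N ≤ ε ⇔ 1ℚ - (1ℚ + 1ℚ) * ε ≤ c)
          (sym (ratio-complement cardC cardD N cardC+cardD+cardD≡N))
          (≤⇔1-2*-≥ (ratio cardD N) ε)

proposition27 : ∀ {N K : ℕ} (m : Fin N → Fin K) (α : Fin N ↔ Fin N) (r : Fin N → Fin N)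
    → Surjective _≡_ _≡_ m
    → (∀ i → r (r i) ≡ i)
    → (∀ i → Inverse.from α i ≡ r (Inverse.to α (r i)))
    → (∀ i → MicroMacro.W m α (r i) ≡ MicroMacro.W m α i)
    → (MicroMacro.cardD m α ≡ MicroMacro.cardI m α)
      × (∀ .{{_ : NonZero N}} (ε : ℚ) → 0ℚ ≤ ε
          → (ratio (MicroMacro.cardD m α) N ≤ ε ⇔ 1ℚ - (1ℚ + 1ℚ) * ε ≤ ratio (MicroMacro.cardC m α) N))
      × (∀ (n : ℕ) → n ≥ 1 → MicroMacro.cardDn m α n ≡ MicroMacro.cardIn m α n)
proposition27 m α r _ r-involutive α⁻¹≡rαr W∘r≗W =
  cardD≡cardI , (λ ε _ → ratioD≤ε⇔1-2ε≤ratioC ε) , (λ n _ → cardDn≡cardIn n)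
  where open ReversibleMicroMacro m α r r-involutive α⁻¹≡rαr W∘r≗W
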